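{- Let $G$ be a connected bipartite graph with vertex classes $A$ and $B$, and let $x_0 \in A$. Let $T$ be any spanning tree of $G$ in which $x_0$ is a leaf, and let $S$ be the set of edges of $G$ not in $T$ that are incident with $x_0$. Then for any orientation $\sigma'$ of the graph $G \setminus (S \cup T)$ (the spanning subgraph of $G$ consisting of the edges of $G$ lying neither in $S$ nor in $T$), there is an orientation $\sigma$ of $G$ which extends $\sigma'$ and satisfies: (i) $d^-_\sigma(x)$ is even for every $x \in B$; (ii) $d^-_\sigma(x)$ is odd for every $x \in A \setminus \{x_0\}$; (iii) $d^-_\sigma(x_0) \leq 1$; (iv) $\sigma$ is a proper orientation of $G$; (v) $\Delta^-(\sigma) \leq \Delta^-(\sigma') + \Delta(T) + 1$.
   Context: All graphs are finite and simple. An orientation of a graph replaces each edge by exactly one of its two possible arcs. For an orientation $\sigma$, $d^-_\sigma(v)$ denotes the indegree of $v$ (number of arcs with head $v$), and $\Delta^-(\sigma)$ denotes the maximum indegree over all vertices. An orientation is proper if $d^-_\sigma(u) \neq d^-_\sigma(v)$ for every edge $uv$. $\Delta(T)$ is the maximum degree of $T$. -}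

module Defs where

open import Data.Nat using (ℕ; zero; suc; _+_; _⊔_)
open import Data.Bool using (Bool; true; false; if_then_else_; _∧_; _∨_; not)
open import Data.Fin using (Fin; _≟_)
open import Data.List using (List; []; _∷_; map; foldr; length; allFin)
open import Data.Nat.ListAction using (sum)
open import Data.List.Relation.Unary.Unique.Propositional using (Unique)
open import Data.Product using (Σ; _×_; _,_)
open import Data.Sum using (_⊎_)
open import Data.Empty using (⊥)
open import Relation.Nullary using (¬_)
open import Relation.Nullary.Decidable using (⌊_⌋)
open import Relation.Binary.PropositionalEquality using (_≡_; _≢_)

-- Undirected edge sets are symmetric irreflexive ones; orientations
-- are relations o with  o u v ≡ true  meaning the arc u → v.
BRel : ℕ → Set
BRel n = Fin n → Fin n → Bool

record SimpleGraph (n : ℕ) : Set where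
  field
    adj    : BRel n
    sym    : ∀ u v → adj u v ≡ adj v u
    irrefl : ∀ v → adj v v ≡ false
open SimpleGraph public

countB : ∀ {n} → (Fin n → Bool) → ℕ
countB {n} p = sum (map (λ u → if p u then 1 else 0) (allFin n))

maxOver : ∀ {n} → (Fin n → ℕ) → ℕ
maxOver {n} f = foldr _⊔_ 0 (map f (allFin n))

deg : ∀ {n} → BRel n → Fin n → ℕ
deg E v = countB (λ u → E v u)

maxDeg : ∀ {n} → BRel n → ℕ
maxDeg E = maxOver (deg E)

indeg : ∀ {n} → BRel n → Fin n → ℕ
indeg o v = countB (λ u → o u v)

maxIndeg : ∀ {n} → BRel n → ℕ
maxIndeg o = maxOver (indeg o)

IsOrientation : ∀ {n} → BRel n → BRel n → Set
IsOrientation {n} E o =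
  (∀ u v → o u v ≡ true → E u v ≡ true) ×
  (∀ u v → E u v ≡ true →
     (o u v ≡ true × o v u ≡ false) ⊎ (o u v ≡ false × o v u ≡ true))

Extends : ∀ {n} → BRel n → BRel n → Set
Extends o o' = ∀ u v → o' u v ≡ true → o u v ≡ true

IsProper : ∀ {n} → SimpleGraph n → BRel n → Set
IsProper G o = ∀ u v → adj G u v ≡ true → indeg o u ≢ indeg o v

data Reach {n} (E : BRel n) : Fin n → Fin n → Set where
  here : ∀ {v} → Reach E v v
  step : ∀ {u w v} → E u w ≡ true → Reach E w v → Reach E u v

Connected : ∀ {n} → BRel n → Set
Connected {n} E = ∀ (u v : Fin n) → Reach E u v

ConsecAdj : ∀ {n} → BRel n → Fin n → List (Fin n) → Fin n → Set
ConsecAdj E u [] first = E u first ≡ true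
ConsecAdj E u (w ∷ ws) first = (E u w ≡ true) × ConsecAdj E w ws first

IsCycle : ∀ {n} → BRel n → List (Fin n) → Set
IsCycle E [] = ⊥
IsCycle E (v ∷ vs) = (2 Data.Nat.≤ length vs) × Unique (v ∷ vs) × ConsecAdj E v vs v

Acyclic : ∀ {n} → BRel n → Set
Acyclic {n} E = ∀ (c : List (Fin n)) → ¬ IsCycle E c

IsSpanningTree : ∀ {n} → SimpleGraph n → SimpleGraph n → Set
IsSpanningTree G T =
  (∀ u v → adj T u v ≡ true → adj G u v ≡ true) ×
  Connected (adj T) × Acyclic (adj T)

-- G is bipartite with vertex classes A (inA v ≡ true) and B (inA v ≡ false)
IsBipartition : ∀ {n} → SimpleGraph n → (Fin n → Bool) → Set
IsBipartition G inA = ∀ u v → adj G u v ≡ true → inA u ≢ inA v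

Sedges : ∀ {n} → SimpleGraph n → SimpleGraph n → Fin n → BRel n
Sedges G T x0 u v =
  adj G u v ∧ not (adj T u v) ∧ (⌊ u ≟ x0 ⌋ ∨ ⌊ v ≟ x0 ⌋)

Rest : ∀ {n} → SimpleGraph n → SimpleGraph n → Fin n → BRel n
Rest G T x0 u v = adj G u v ∧ not (Sedges G T x0 u v ∨ adj T u v)

-- Orient the tree edges arbitrarily, the edges of S away from x₀ and the remaining
-- edges as σ'. Reversing the arcs of a set F of tree edges preserves all of this
-- and changes the parity of the indegree exactly at the vertices of odd F-degree.
-- In a connected graph any parity prescription on the vertices other than a root is
-- realised by such an F (a T-join, built as a sum of walks to the root), so we can
-- make indegrees even on B and odd on A ∖ {x₀}. Only the tree edge at the leaf x₀
-- can enter x₀, so d⁻(x₀) ≤ 1, and every vertex gains at most its tree degree plus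
-- the arc from x₀ over σ'. Properness follows from the parities, except along an
-- edge x₀y, where d⁻(y) would have to be the even number d⁻(x₀) ≤ 1, hence 0,
-- although the edge x₀y enters y or x₀.
module Submission where

open import Defs hiding (sym)
import Algebra.Properties.CommutativeSemigroup as CommutativeSemigroupProperties
open import Data.Bool using (Bool; true; false; not; _∧_; _∨_; _xor_; if_then_else_)
open import Data.Bool.Properties
  using (∧-comm; ∧-identityʳ; ∧-zeroʳ; ∨-zeroʳ; xor-comm; not-distribʳ-xor; if-float)
open import Data.Empty using (⊥; ⊥-elim)
open import Data.Fin using (Fin; zero; suc; _≟_; _<?_)
open import Data.Fin.Properties using (<-cmp)
open import Data.List using (List; []; _∷_; map; allFin)
open import Data.List.Properties using (map-tabulate; foldr-preservesᵇ; foldr-preservesᵒ)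
open import Data.List.Membership.Propositional using (_∈_)
open import Data.List.Membership.Propositional.Properties using (∈-allFin)
import Data.List.Relation.Unary.All.Properties as All
import Data.List.Relation.Unary.Any.Properties as Any
open import Data.List.Relation.Unary.Any using (here; there)
open import Data.Nat using (ℕ; suc; _≤_; _+_; _⊔_; z≤n; s≤s; parity)
open import Data.Nat.Divisibility using (_∣_; divides; _∣0; ∣-refl; ∣m∣n⇒∣m+n)
open import Data.Nat.ListAction using (sum)
import Data.Nat.Properties as ℕ
open import Data.Parity.Base as ℙ using (Parity; 0ℙ; 1ℙ; _⁻¹)
import Data.Parity.Properties as ℙ
open import Data.Product using (Σ; _×_; _,_; proj₁; proj₂)
open import Data.Sum using (_⊎_; inj₁; inj₂)
open import Function using (_∘_; id)
open import Relation.Binary using (tri<; tri≈; tri>)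
open import Relation.Binary.PropositionalEquality
  using (_≡_; _≢_; refl; sym; trans; cong; cong₂; module ≡-Reasoning)
open import Relation.Nullary using (Dec; ¬_; yes; no)
open import Relation.Nullary.Decidable using (⌊_⌋; isYes≗does; dec-true; dec-false; ⌊⌋-map′)

⌊⌋-true : ∀ {a} {A : Set a} (d : Dec A) → A → ⌊ d ⌋ ≡ true
⌊⌋-true d a = trans (isYes≗does d) (dec-true d a)

⌊⌋-false : ∀ {a} {A : Set a} (d : Dec A) → ¬ A → ⌊ d ⌋ ≡ false
⌊⌋-false d ¬a = trans (isYes≗does d) (dec-false d ¬a)

⌊⌋-sound : ∀ {a} {A : Set a} (d : Dec A) → ⌊ d ⌋ ≡ true → A
⌊⌋-sound (yes a) _ = a

xor≡true : ∀ a b → a xor b ≡ true → a ≡ true ⊎ b ≡ true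
xor≡true true  _ _ = inj₁ refl
xor≡true false _ e = inj₂ e

∧≡true : ∀ a b → a ∧ b ≡ true → a ≡ true × b ≡ true
∧≡true true true _ = refl , refl

true≢false : true ≢ false
true≢false ()

∨-introˡ : ∀ {a} b → a ≡ true → a ∨ b ≡ true
∨-introˡ _ refl = refl

∨-introʳ : ∀ a {b} → b ≡ true → a ∨ b ≡ true
∨-introʳ a refl = ∨-zeroʳ a

-- countB p unfolds to countIn (allFin n) p, so these lemmas apply to indeg and deg.
countIn : ∀ {A : Set} → List A → (A → Bool) → ℕ
countIn xs p = sum (map (λ u → if p u then 1 else 0) xs)

module _ {A : Set} where

  countIn-cong : ∀ (xs : List A) {p q : A → Bool} →
                 (∀ u → p u ≡ q u) → countIn xs p ≡ countIn xs q
  countIn-cong []       p≗q = refl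
  countIn-cong (x ∷ xs) p≗q = cong₂ _+_ (cong (λ b → if b then 1 else 0) (p≗q x)) (countIn-cong xs p≗q)

  countIn-false : ∀ (xs : List A) → countIn xs (λ _ → false) ≡ 0
  countIn-false []       = refl
  countIn-false (_ ∷ xs) = countIn-false xs

  countIn-mono : ∀ (xs : List A) {p q : A → Bool} →
                 (∀ u → p u ≡ true → q u ≡ true) → countIn xs p ≤ countIn xs q
  countIn-mono []       p⇒q = z≤n
  countIn-mono (x ∷ xs) {p} {q} p⇒q = ℕ.+-mono-≤ (head (p x) (q x) (p⇒q x)) (countIn-mono xs p⇒q)
    where
    head : ∀ a b → (a ≡ true → b ≡ true) → (if a then 1 else 0) ≤ (if b then 1 else 0)
    head false _ _   = z≤n
    head true  b a⇒b rewrite a⇒b refl = ℕ.≤-refl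

  countIn-∨ : ∀ (xs : List A) (p q : A → Bool) →
              countIn xs (λ u → p u ∨ q u) ≤ countIn xs p + countIn xs q
  countIn-∨ []       p q = z≤n
  countIn-∨ (x ∷ xs) p q = begin
    (if p x ∨ q x then 1 else 0) + countIn xs (λ u → p u ∨ q u)
      ≤⟨ ℕ.+-mono-≤ (head (p x) (q x)) (countIn-∨ xs p q) ⟩
    ((if p x then 1 else 0) + (if q x then 1 else 0)) + (countIn xs p + countIn xs q)
      ≡⟨ interchange (if p x then 1 else 0) (if q x then 1 else 0) (countIn xs p) (countIn xs q) ⟩
    countIn (x ∷ xs) p + countIn (x ∷ xs) q ∎
    where
    open ℕ.≤-Reasoning
    open CommutativeSemigroupProperties ℕ.+-commutativeSemigroup using (interchange)
    head : ∀ a b → (if a ∨ b then 1 else 0) ≤ (if a then 1 else 0) + (if b then 1 else 0)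
    head true  _ = s≤s z≤n
    head false _ = ℕ.≤-refl

  countIn-∈ : ∀ {xs : List A} {a} (p : A → Bool) → a ∈ xs → p a ≡ true → 1 ≤ countIn xs p
  countIn-∈ p (here refl) pa rewrite pa = s≤s z≤n
  countIn-∈ {x ∷ _} p (there a∈xs) pa = ℕ.≤-trans (countIn-∈ p a∈xs pa) (ℕ.m≤n+m _ _)

  parity-countIn-xor : ∀ (xs : List A) (p q : A → Bool) →
    parity (countIn xs (λ u → p u xor q u)) ≡ parity (countIn xs p) ℙ.+ parity (countIn xs q)
  parity-countIn-xor []       p q = refl
  parity-countIn-xor (x ∷ xs) p q = begin
    parity ((if p x xor q x then 1 else 0) + countIn xs (λ u → p u xor q u))
      ≡⟨ ℙ.+-homo-+ (if p x xor q x then 1 else 0) _ ⟩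
    parity (if p x xor q x then 1 else 0) ℙ.+ parity (countIn xs (λ u → p u xor q u))
      ≡⟨ cong₂ ℙ._+_ (head (p x) (q x)) (parity-countIn-xor xs p q) ⟩
    (parity (if p x then 1 else 0) ℙ.+ parity (if q x then 1 else 0))
      ℙ.+ (parity (countIn xs p) ℙ.+ parity (countIn xs q))
      ≡⟨ interchange (parity (if p x then 1 else 0)) (parity (if q x then 1 else 0))
                     (parity (countIn xs p)) (parity (countIn xs q)) ⟩
    (parity (if p x then 1 else 0) ℙ.+ parity (countIn xs p))
      ℙ.+ (parity (if q x then 1 else 0) ℙ.+ parity (countIn xs q))
      ≡⟨ sym (cong₂ ℙ._+_ (ℙ.+-homo-+ (if p x then 1 else 0) _) (ℙ.+-homo-+ (if q x then 1 else 0) _)) ⟩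
    parity (countIn (x ∷ xs) p) ℙ.+ parity (countIn (x ∷ xs) q) ∎
    where
    open ≡-Reasoning
    open CommutativeSemigroupProperties ℙ.+-commutativeSemigroup using (interchange)
    head : ∀ a b → parity (if a xor b then 1 else 0)
                 ≡ parity (if a then 1 else 0) ℙ.+ parity (if b then 1 else 0)
    head true  true  = refl
    head true  false = refl
    head false _     = refl

countB-suc : ∀ {n} (p : Fin (suc n) → Bool) →
             countB p ≡ (if p zero then 1 else 0) + countB (p ∘ suc)
countB-suc p = cong (λ xs → (if p zero then 1 else 0) + sum xs)
  (trans (map-tabulate suc count) (sym (map-tabulate id (count ∘ suc))))
  where
  count : Fin (suc _) → ℕ
  count u = if p u then 1 else 0

countB-single : ∀ {n} (a : Fin n) → countB (λ u → ⌊ u ≟ a ⌋) ≡ 1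
countB-single {suc n} zero =
  trans (countB-suc {n} (λ u → ⌊ u ≟ zero ⌋)) (cong suc (countIn-false (allFin n)))
countB-single {suc n} (suc a) = begin
  countB (λ u → ⌊ u ≟ suc a ⌋)             ≡⟨ countB-suc (λ u → ⌊ u ≟ suc a ⌋) ⟩
  countB (λ u → ⌊ suc u ≟ suc a ⌋)         ≡⟨ countIn-cong (allFin n) (λ u → ⌊⌋-map′ _ _ (u ≟ a)) ⟩
  countB (λ u → ⌊ u ≟ a ⌋)                 ≡⟨ countB-single a ⟩
  1                                        ∎
  where open ≡-Reasoning

parity≡0ℙ⇒2∣ : ∀ m → parity m ≡ 0ℙ → 2 ∣ m
parity≡0ℙ⇒2∣ 0             _ = 2 ∣0
parity≡0ℙ⇒2∣ (suc (suc m)) e = ∣m∣n⇒∣m+n ∣-refl (parity≡0ℙ⇒2∣ m e)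

2∣⇒parity≡0ℙ : ∀ {m} → 2 ∣ m → parity m ≡ 0ℙ
2∣⇒parity≡0ℙ (divides q refl) = trans (ℙ.*-homo-* q 2) (ℙ.*-zeroʳ (parity q))

toParity : Bool → Parity
toParity b = if b then 1ℙ else 0ℙ

toParity-injective : ∀ {a b} → toParity a ≡ toParity b → a ≡ b
toParity-injective {true}  {true}  _ = refl
toParity-injective {false} {false} _ = refl

1ℙ≢0ℙ : 1ℙ ≢ 0ℙ
1ℙ≢0ℙ ()

p≢q⇒p⁻¹≡q : ∀ {p q : Parity} → p ≢ q → p ⁻¹ ≡ q
p≢q⇒p⁻¹≡q {0ℙ} {0ℙ} p≢q = ⊥-elim (p≢q refl)
p≢q⇒p⁻¹≡q {0ℙ} {1ℙ} _   = refl
p≢q⇒p⁻¹≡q {1ℙ} {0ℙ} _   = refl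
p≢q⇒p⁻¹≡q {1ℙ} {1ℙ} p≢q = ⊥-elim (p≢q refl)

p+q+q≡p : ∀ p q → (p ℙ.+ q) ℙ.+ q ≡ p
p+q+q≡p p q = trans (ℙ.+-assoc p q q) (trans (cong (p ℙ.+_) (ℙ.p+p≡0ℙ q)) (ℙ.+-identityʳ p))

+-cancel-middle : ∀ p q r → (p ℙ.+ q) ℙ.+ (q ℙ.+ r) ≡ p ℙ.+ r
+-cancel-middle p q r = begin
  (p ℙ.+ q) ℙ.+ (q ℙ.+ r)   ≡⟨ ℙ.+-assoc p q (q ℙ.+ r) ⟩
  p ℙ.+ (q ℙ.+ (q ℙ.+ r))   ≡⟨ cong (p ℙ.+_) (sym (ℙ.+-assoc q q r)) ⟩
  p ℙ.+ ((q ℙ.+ q) ℙ.+ r)   ≡⟨ cong (λ s → p ℙ.+ (s ℙ.+ r)) (ℙ.p+p≡0ℙ q) ⟩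
  p ℙ.+ r                   ∎
  where open ≡-Reasoning

maxOver-upper : ∀ {n} (f : Fin n → ℕ) v → f v ≤ maxOver f
maxOver-upper f v = foldr-preservesᵒ upper 0 (map f (allFin _))
  (inj₂ (Any.map⁺ (Any.tabulate⁺ {P = λ u → f v ≤ f u} v ℕ.≤-refl)))
  where
  upper : ∀ x y → f v ≤ x ⊎ f v ≤ y → f v ≤ x ⊔ y
  upper x y (inj₁ le) = ℕ.m≤n⇒m≤n⊔o y le
  upper x y (inj₂ le) = ℕ.m≤n⇒m≤o⊔n x le

maxOver-least : ∀ {n} (f : Fin n → ℕ) {b} → (∀ v → f v ≤ b) → maxOver f ≤ b
maxOver-least f {b} f≤b = foldr-preservesᵇ {P = _≤ b} ℕ.⊔-lub z≤n (All.map⁺ (All.tabulate⁺ f≤b))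

module _ {n : ℕ} where

  ∅ : BRel n
  ∅ _ _ = false

  -- F ⊕ o reverses the arcs of o along the edges listed (in both directions) in F.
  _⊕_ : BRel n → BRel n → BRel n
  (F ⊕ o) u v = F u v xor o u v

  arc : Fin n → Fin n → BRel n
  arc a b u v = ⌊ u ≟ a ⌋ ∧ ⌊ v ≟ b ⌋

  edge : Fin n → Fin n → BRel n
  edge a b = arc a b ⊕ arc b a

  δ : Fin n → Fin n → Parity
  δ a v = toParity ⌊ v ≟ a ⌋

  δ-self : ∀ a → δ a a ≡ 1ℙ
  δ-self a = cong toParity (⌊⌋-true (a ≟ a) refl)

  δ-≢ : ∀ {a v} → v ≢ a → δ a v ≡ 0ℙ
  δ-≢ {a} {v} v≢a = cong toParity (⌊⌋-false (v ≟ a) v≢a)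

  parity-indeg-⊕ : ∀ (F o : BRel n) v →
                   parity (indeg (F ⊕ o) v) ≡ parity (indeg F v) ℙ.+ parity (indeg o v)
  parity-indeg-⊕ F o v = parity-countIn-xor (allFin n) (λ u → F u v) (λ u → o u v)

  parity-indeg-∅ : ∀ v → parity (indeg ∅ v) ≡ 0ℙ
  parity-indeg-∅ v = cong parity (countIn-false (allFin n))

  parity-indeg-arc : ∀ a b v → parity (indeg (arc a b) v) ≡ δ b v
  parity-indeg-arc a b v = trans (cong parity (count (⌊ v ≟ b ⌋))) (if-float parity ⌊ v ≟ b ⌋)
    where
    count : ∀ c → countB (λ u → ⌊ u ≟ a ⌋ ∧ c) ≡ (if c then 1 else 0)
    count true  = trans (countIn-cong (allFin n) (λ u → ∧-identityʳ _)) (countB-single a)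
    count false = trans (countIn-cong (allFin n) (λ u → ∧-zeroʳ _)) (countIn-false (allFin n))

  parity-indeg-edge : ∀ a b v → parity (indeg (edge a b) v) ≡ δ a v ℙ.+ δ b v
  parity-indeg-edge a b v = begin
    parity (indeg (edge a b) v)                            ≡⟨ parity-indeg-⊕ (arc a b) (arc b a) v ⟩
    parity (indeg (arc a b) v) ℙ.+ parity (indeg (arc b a) v)
      ≡⟨ cong₂ ℙ._+_ (parity-indeg-arc a b v) (parity-indeg-arc b a v) ⟩
    δ b v ℙ.+ δ a v                                        ≡⟨ ℙ.+-comm (δ b v) (δ a v) ⟩
    δ a v ℙ.+ δ b v                                        ∎
    where open ≡-Reasoning

record EdgeSubset {n} (G : SimpleGraph n) (F : BRel n) : Set where
  field
    symmetric : ∀ u v → F u v ≡ F v u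
    ⊆-adj     : ∀ u v → F u v ≡ true → adj G u v ≡ true
open EdgeSubset

module _ {n} {G : SimpleGraph n} where

  ∅-edgeSubset : EdgeSubset G ∅
  ∅-edgeSubset = record { symmetric = λ _ _ → refl ; ⊆-adj = λ _ _ () }

  ⊕-edgeSubset : ∀ {F F′} → EdgeSubset G F → EdgeSubset G F′ → EdgeSubset G (F ⊕ F′)
  ⊕-edgeSubset {F} {F′} sF sF′ = record
    { symmetric = λ u v → cong₂ _xor_ (symmetric sF u v) (symmetric sF′ u v)
    ; ⊆-adj     = λ u v e → case (xor≡true (F u v) (F′ u v) e)
    }
    where
    case : ∀ {u v} → F u v ≡ true ⊎ F′ u v ≡ true → adj G u v ≡ true
    case (inj₁ e) = ⊆-adj sF _ _ e
    case (inj₂ e) = ⊆-adj sF′ _ _ e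

  edge-edgeSubset : ∀ {a b} → adj G a b ≡ true → EdgeSubset G (edge a b)
  edge-edgeSubset {a} {b} ab = record
    { symmetric = λ u v → trans (cong₂ _xor_ (∧-comm ⌊ u ≟ a ⌋ _) (∧-comm ⌊ u ≟ b ⌋ _))
                                (xor-comm (arc b a v u) (arc a b v u))
    ; ⊆-adj     = λ u v e → case u v (xor≡true (arc a b u v) (arc b a u v) e)
    }
    where
    arc-endpoints : ∀ {a b u v} → arc a b u v ≡ true → u ≡ a × v ≡ b
    arc-endpoints {a} {b} {u} {v} e with ∧≡true ⌊ u ≟ a ⌋ ⌊ v ≟ b ⌋ e
    ... | ua , vb = ⌊⌋-sound (u ≟ a) ua , ⌊⌋-sound (v ≟ b) vb
    case : ∀ u v → arc a b u v ≡ true ⊎ arc b a u v ≡ true → adj G u v ≡ true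
    case u v (inj₁ e) with arc-endpoints {a} {b} {u} {v} e
    ... | refl , refl = ab
    case u v (inj₂ e) with arc-endpoints {b} {a} {u} {v} e
    ... | refl , refl = trans (SimpleGraph.sym G b a) ab

  walkEdges : ∀ {s t} → Reach (adj G) s t → BRel n
  walkEdges here                  = ∅
  walkEdges (step {u} {w} _ walk) = edge u w ⊕ walkEdges walk

  walkEdges-edgeSubset : ∀ {s t} (walk : Reach (adj G) s t) → EdgeSubset G (walkEdges walk)
  walkEdges-edgeSubset here            = ∅-edgeSubset
  walkEdges-edgeSubset (step uw walk) = ⊕-edgeSubset (edge-edgeSubset uw) (walkEdges-edgeSubset walk)

  parity-indeg-walkEdges : ∀ {s t} (walk : Reach (adj G) s t) v →
                           parity (indeg (walkEdges walk) v) ≡ δ s v ℙ.+ δ t v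
  parity-indeg-walkEdges {s} here v = trans (parity-indeg-∅ v) (sym (ℙ.p+p≡0ℙ (δ s v)))
  parity-indeg-walkEdges {s} {t} (step {w = w} _ walk) v = begin
    parity (indeg (edge s w ⊕ walkEdges walk) v)
      ≡⟨ parity-indeg-⊕ (edge s w) (walkEdges walk) v ⟩
    parity (indeg (edge s w) v) ℙ.+ parity (indeg (walkEdges walk) v)
      ≡⟨ cong₂ ℙ._+_ (parity-indeg-edge s w v) (parity-indeg-walkEdges walk v) ⟩
    (δ s v ℙ.+ δ w v) ℙ.+ (δ w v ℙ.+ δ t v)
      ≡⟨ +-cancel-middle (δ s v) (δ w v) (δ t v) ⟩
    δ s v ℙ.+ δ t v ∎
    where open ≡-Reasoning

  ParityJoin : Fin n → (Fin n → Parity) → (Fin n → Set) → Set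
  ParityJoin root target inScope =
    Σ (BRel n) λ F → EdgeSubset G F × (∀ v → inScope v → v ≢ root → parity (indeg F v) ≡ target v)

  module _ (connected : Connected (adj G)) (root : Fin n) (target : Fin n → Parity) where

    -- Process the vertices one by one: a walk from v to the root flips the parity at v
    -- and at the root only.
    parityJoinOn : ∀ vs → ParityJoin root target (_∈ vs)
    parityJoinOn [] = ∅ , ∅-edgeSubset , λ _ ()
    parityJoinOn (v ∷ vs) with parityJoinOn vs
    ... | F , sF , F-ok with parity (indeg F v) ℙ.≟ target v
    ...   | yes F-ok-v = F , sF , ok
      where
      ok : ∀ u → u ∈ v ∷ vs → u ≢ root → parity (indeg F u) ≡ target u
      ok u (here refl)  _      = F-ok-v
      ok u (there u∈vs) u≢root = F-ok u u∈vs u≢root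
    ...   | no F-bad-v =
      walkEdges (connected v root) ⊕ F , ⊕-edgeSubset (walkEdges-edgeSubset (connected v root)) sF , ok
      where
      flip : ∀ u → u ≢ root → parity (indeg (walkEdges (connected v root) ⊕ F) u)
                             ≡ δ v u ℙ.+ parity (indeg F u)
      flip u u≢root = begin
        parity (indeg (walkEdges (connected v root) ⊕ F) u)
          ≡⟨ parity-indeg-⊕ (walkEdges (connected v root)) F u ⟩
        parity (indeg (walkEdges (connected v root)) u) ℙ.+ parity (indeg F u)
          ≡⟨ cong (ℙ._+ parity (indeg F u)) (parity-indeg-walkEdges (connected v root) u) ⟩
        (δ v u ℙ.+ δ root u) ℙ.+ parity (indeg F u)
          ≡⟨ cong (λ p → (δ v u ℙ.+ p) ℙ.+ parity (indeg F u)) (δ-≢ u≢root) ⟩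
        (δ v u ℙ.+ 0ℙ) ℙ.+ parity (indeg F u)
          ≡⟨ cong (ℙ._+ parity (indeg F u)) (ℙ.+-identityʳ (δ v u)) ⟩
        δ v u ℙ.+ parity (indeg F u) ∎
        where open ≡-Reasoning
      ok : ∀ u → u ∈ v ∷ vs → u ≢ root →
           parity (indeg (walkEdges (connected v root) ⊕ F) u) ≡ target u
      ok u u∈ u≢root with u ≟ v | u∈
      ... | yes refl | _ = trans (flip u u≢root)
                             (trans (cong (ℙ._+ parity (indeg F u)) (δ-self u)) (p≢q⇒p⁻¹≡q F-bad-v))
      ... | no u≢v | here u≡v = ⊥-elim (u≢v u≡v)
      ... | no u≢v | there u∈vs = trans (flip u u≢root)
                                    (trans (cong (ℙ._+ parity (indeg F u)) (δ-≢ u≢v)) (F-ok u u∈vs u≢root))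

  parityJoin : Connected (adj G) → (root : Fin n) (target : Fin n → Parity) →
               Σ (BRel n) λ F → EdgeSubset G F × (∀ v → v ≢ root → parity (indeg F v) ≡ target v)
  parityJoin connected root target with parityJoinOn connected root target (allFin n)
  ... | F , sF , F-ok = F , sF , λ v → F-ok v (∈-allFin v)

Orients : ∀ {n} → BRel n → BRel n → Set
Orients E o = (∀ u v → o u v ≡ true → E u v ≡ true) ×
              (∀ u v → E u v ≡ true → o v u ≡ not (o u v))

orients⇒isOrientation : ∀ {n} {E o : BRel n} → Orients E o → IsOrientation E o
orients⇒isOrientation {E = E} {o} (o⊆E , antisym) = o⊆E , oneWay
  where
  oneWay : ∀ u v → E u v ≡ true → (o u v ≡ true × o v u ≡ false) ⊎ (o u v ≡ false × o v u ≡ true)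
  oneWay u v uv with o u v in ouv
  ... | true  = inj₁ (refl , trans (antisym u v uv) (cong not ouv))
  ... | false = inj₂ (refl , trans (antisym u v uv) (cong not ouv))

⊕-orients : ∀ {n} {H : SimpleGraph n} {E F o : BRel n} → EdgeSubset H F →
            (∀ u v → adj H u v ≡ true → E u v ≡ true) → Orients E o → Orients E (F ⊕ o)
⊕-orients {E = E} {F} {o} sF H⊆E (o⊆E , antisym) = ⊆E , λ u v uv →
  trans (cong₂ _xor_ (symmetric sF v u) (antisym u v uv)) (sym (not-distribʳ-xor (F u v) (o u v)))
  where
  ⊆E : ∀ u v → (F ⊕ o) u v ≡ true → E u v ≡ true
  ⊆E u v e with xor≡true (F u v) (o u v) e
  ... | inj₁ Fuv = H⊆E u v (⊆-adj sF u v Fuv)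
  ... | inj₂ ouv = o⊆E u v ouv

⌊<?⌋-flip : ∀ {n} {u v : Fin n} → u ≢ v → ⌊ v <? u ⌋ ≡ not ⌊ u <? v ⌋
⌊<?⌋-flip {u = u} {v} u≢v with <-cmp u v
... | tri< u<v _ v≮u = trans (⌊⌋-false (v <? u) v≮u) (cong not (sym (⌊⌋-true (u <? v) u<v)))
... | tri≈ _ u≡v _   = ⊥-elim (u≢v u≡v)
... | tri> u≮v _ v<u = trans (⌊⌋-true (v <? u) v<u) (cong not (sym (⌊⌋-false (u <? v) u≮v)))

adj-irrefl : ∀ {n} (G : SimpleGraph n) {u v} → adj G u v ≡ true → u ≢ v
adj-irrefl G {u} uv refl with trans (sym uv) (irrefl G u)
... | ()

indeg-≤-sources : ∀ {n} (o σ' E : BRel n) (x v : Fin n) →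
  (∀ u → o u v ≡ true → σ' u v ≡ true ⊎ E v u ≡ true ⊎ u ≡ x) →
  indeg o v ≤ indeg σ' v + deg E v + 1
indeg-≤-sources {n} o σ' E x v sources = begin
  indeg o v
    ≤⟨ countIn-mono (allFin n) covered ⟩
  countB (λ u → σ' u v ∨ (E v u ∨ ⌊ u ≟ x ⌋))
    ≤⟨ countIn-∨ (allFin n) (λ u → σ' u v) (λ u → E v u ∨ ⌊ u ≟ x ⌋) ⟩
  indeg σ' v + countB (λ u → E v u ∨ ⌊ u ≟ x ⌋)
    ≤⟨ ℕ.+-monoʳ-≤ (indeg σ' v) (countIn-∨ (allFin n) (E v) (λ u → ⌊ u ≟ x ⌋)) ⟩
  indeg σ' v + (deg E v + countB (λ u → ⌊ u ≟ x ⌋))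
    ≡⟨ cong (λ k → indeg σ' v + (deg E v + k)) (countB-single x) ⟩
  indeg σ' v + (deg E v + 1)
    ≡⟨ sym (ℕ.+-assoc (indeg σ' v) (deg E v) 1) ⟩
  indeg σ' v + deg E v + 1 ∎
  where
  open ℕ.≤-Reasoning
  covered : ∀ u → o u v ≡ true → (σ' u v ∨ (E v u ∨ ⌊ u ≟ x ⌋)) ≡ true
  covered u e with sources u e
  ... | inj₁ σ'uv       = ∨-introˡ _ σ'uv
  ... | inj₂ (inj₁ Evu) = ∨-introʳ (σ' u v) (∨-introˡ _ Evu)
  ... | inj₂ (inj₂ u≡x) = ∨-introʳ (σ' u v) (∨-introʳ (E v u) (⌊⌋-true (u ≟ x) u≡x))

maxIndeg-≤-sources : ∀ {n} (o σ' E : BRel n) (x : Fin n) →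
  (∀ u v → o u v ≡ true → σ' u v ≡ true ⊎ E v u ≡ true ⊎ u ≡ x) →
  maxIndeg o ≤ maxIndeg σ' + maxDeg E + 1
maxIndeg-≤-sources o σ' E x sources = maxOver-least (indeg o) λ v →
  ℕ.≤-trans (indeg-≤-sources o σ' E x v (λ u → sources u v))
            (ℕ.+-monoˡ-≤ 1 (ℕ.+-mono-≤ (maxOver-upper (indeg σ') v) (maxOver-upper (deg E) v)))

isProper-byParity : ∀ {n} (G : SimpleGraph n) (inA : Fin n → Bool) {x0 : Fin n} {o : BRel n} →
  IsOrientation (adj G) o → IsBipartition G inA → inA x0 ≡ true →
  (∀ v → v ≢ x0 → parity (indeg o v) ≡ toParity (inA v)) → indeg o x0 ≤ 1 → IsProper G o
isProper-byParity G inA {x0} {o} (_ , oneWay) bip x0∈A parity-o x0≤1 u v uv same =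
  byEnds (u ≟ x0) (v ≟ x0)
  where
  neighbour : ∀ {y} → adj G x0 y ≡ true → y ≢ x0 → indeg o x0 ≢ indeg o y
  neighbour {y} x0y y≢x0 x0~y = 1ℙ≢0ℙ (begin
    1ℙ                   ≡⟨ cong parity (sym indeg≡1) ⟩
    parity (indeg o y)   ≡⟨ parity-o y y≢x0 ⟩
    toParity (inA y)     ≡⟨ cong toParity y∈B ⟩
    0ℙ                   ∎)
    where
    open ≡-Reasoning
    y∈B : inA y ≡ false
    y∈B with inA y in e
    ... | false = refl
    ... | true  = ⊥-elim (bip x0 y x0y (trans x0∈A (sym e)))
    indeg≥1 : 1 ≤ indeg o y
    indeg≥1 with oneWay x0 y x0y
    ... | inj₁ (x0→y , _) = countIn-∈ (λ w → o w y) (∈-allFin x0) x0→y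
    ... | inj₂ (_ , y→x0) =
      ℕ.≤-trans (countIn-∈ (λ w → o w x0) (∈-allFin y) y→x0) (ℕ.≤-reflexive x0~y)
    indeg≡1 : indeg o y ≡ 1
    indeg≡1 = ℕ.≤-antisym (ℕ.≤-trans (ℕ.≤-reflexive (sym x0~y)) x0≤1) indeg≥1
  byEnds : Dec (u ≡ x0) → Dec (v ≡ x0) → ⊥
  byEnds (yes u≡x0) (yes v≡x0) = adj-irrefl G uv (trans u≡x0 (sym v≡x0))
  byEnds (yes refl) (no v≢x0)  = neighbour uv v≢x0 same
  byEnds (no u≢x0) (yes refl)  = neighbour (trans (SimpleGraph.sym G v u) uv) u≢x0 (sym same)
  byEnds (no u≢x0) (no v≢x0)   =
    bip u v uv (toParity-injective
      (trans (sym (parity-o u u≢x0)) (trans (cong parity same) (parity-o v v≢x0))))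

-- The base orientation and its reversals along tree edges

module Reorientation {n} (G T : SimpleGraph n) (x0 : Fin n) {σ' : BRel n}
  (T⊆G : ∀ u v → adj T u v ≡ true → adj G u v ≡ true)
  (σ'-orients : IsOrientation (Rest G T x0) σ') where

  private
    σ'⊆Rest : ∀ u v → σ' u v ≡ true → Rest G T x0 u v ≡ true
    σ'⊆Rest = proj₁ σ'-orients

  Rest⊆adj : ∀ u v → Rest G T x0 u v ≡ true → adj G u v ≡ true
  Rest⊆adj u v e = proj₁ (∧≡true (adj G u v) _ e)

  Rest-∉T : ∀ u v → adj T u v ≡ true → Rest G T x0 u v ≡ false
  Rest-∉T u v uv rewrite uv with adj G u v
  ... | true  = refl
  ... | false = refl

  Rest-into-x0 : ∀ u → Rest G T x0 u x0 ≡ false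
  Rest-into-x0 u rewrite ⌊⌋-true (x0 ≟ x0) refl | ∨-zeroʳ ⌊ u ≟ x0 ⌋ with adj G u x0 | adj T u x0
  ... | false | _     = refl
  ... | true  | true  = refl
  ... | true  | false = refl

  Rest-intro : ∀ {u v} → adj G u v ≡ true → adj T u v ≡ false → u ≢ x0 → v ≢ x0 →
               Rest G T x0 u v ≡ true
  Rest-intro {u} {v} uv ¬Tuv u≢x0 v≢x0
    rewrite uv | ¬Tuv | ⌊⌋-false (u ≟ x0) u≢x0 | ⌊⌋-false (v ≟ x0) v≢x0 = refl

  σ'-∉T : ∀ u v → σ' u v ≡ true → adj T u v ≡ false
  σ'-∉T u v e with adj T u v in uv
  ... | false = refl
  ... | true with trans (sym (σ'⊆Rest u v e)) (Rest-∉T u v uv)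
  ...   | ()

  σ'-into-x0 : ∀ u → σ' u x0 ≡ false
  σ'-into-x0 u with σ' u x0 in e
  ... | false = refl
  ... | true with trans (sym (σ'⊆Rest u x0 e)) (Rest-into-x0 u)
  ...   | ()

  σ₀ : BRel n
  σ₀ u v = if adj T u v then ⌊ u <? v ⌋ else (if ⌊ u ≟ x0 ⌋ then adj G u v else σ' u v)

  σ₀-T : ∀ {u v} → adj T u v ≡ true → σ₀ u v ≡ ⌊ u <? v ⌋
  σ₀-T uv rewrite uv = refl

  σ₀-x0 : ∀ {u v} → adj T u v ≡ false → u ≡ x0 → σ₀ u v ≡ adj G u v
  σ₀-x0 {u} ¬T u≡x0 rewrite ¬T | ⌊⌋-true (u ≟ x0) u≡x0 = refl

  σ₀-σ' : ∀ {u v} → adj T u v ≡ false → u ≢ x0 → σ₀ u v ≡ σ' u v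
  σ₀-σ' {u} ¬T u≢x0 rewrite ¬T | ⌊⌋-false (u ≟ x0) u≢x0 = refl

  σ₀-source : ∀ u v → σ₀ u v ≡ true → adj T u v ≡ true ⊎ σ' u v ≡ true ⊎ u ≡ x0
  σ₀-source u v e with adj T u v in uv | u ≟ x0
  ... | true  | _          = inj₁ refl
  ... | false | yes u≡x0   = inj₂ (inj₂ u≡x0)
  ... | false | no _       = inj₂ (inj₁ e)

  σ₀-extends : Extends σ₀ σ'
  σ₀-extends u v e = extend (u ≟ x0)
    where
    extend : Dec (u ≡ x0) → σ₀ u v ≡ true
    extend (yes u≡x0) = trans (σ₀-x0 (σ'-∉T u v e) u≡x0) (Rest⊆adj u v (σ'⊆Rest u v e))
    extend (no u≢x0)  = trans (σ₀-σ' (σ'-∉T u v e) u≢x0) e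

  σ₀-orients : Orients (adj G) σ₀
  σ₀-orients = ⊆G , antisym
    where
    ⊆G : ∀ u v → σ₀ u v ≡ true → adj G u v ≡ true
    ⊆G u v e with adj T u v in uv | u ≟ x0
    ... | true  | _     = T⊆G u v uv
    ... | false | yes _ = e
    ... | false | no _  = Rest⊆adj u v (σ'⊆Rest u v e)
    exactlyOne⇒not : ∀ {a b} → (a ≡ true × b ≡ false) ⊎ (a ≡ false × b ≡ true) → b ≡ not a
    exactlyOne⇒not (inj₁ (refl , refl)) = refl
    exactlyOne⇒not (inj₂ (refl , refl)) = refl
    open ≡-Reasoning
    antisym : ∀ u v → adj G u v ≡ true → σ₀ v u ≡ not (σ₀ u v)
    antisym u v uv = byTree (adj T u v) refl
      where
      byTree : ∀ b → adj T u v ≡ b → σ₀ v u ≡ not (σ₀ u v)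
      byTree true Tuv = begin
        σ₀ v u           ≡⟨ σ₀-T (trans (SimpleGraph.sym T v u) Tuv) ⟩
        ⌊ v <? u ⌋       ≡⟨ ⌊<?⌋-flip (adj-irrefl G uv) ⟩
        not ⌊ u <? v ⌋   ≡⟨ cong not (sym (σ₀-T Tuv)) ⟩
        not (σ₀ u v)     ∎
      byTree false Tuv = byEnds (u ≟ x0) (v ≟ x0)
        where
        Tvu : adj T v u ≡ false
        Tvu = trans (SimpleGraph.sym T v u) Tuv
        byEnds : Dec (u ≡ x0) → Dec (v ≡ x0) → σ₀ v u ≡ not (σ₀ u v)
        byEnds (yes u≡x0) (yes v≡x0) = ⊥-elim (adj-irrefl G uv (trans u≡x0 (sym v≡x0)))
        byEnds (yes u≡x0) (no v≢x0) = begin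
          σ₀ v u         ≡⟨ σ₀-σ' Tvu v≢x0 ⟩
          σ' v u         ≡⟨ cong (σ' v) u≡x0 ⟩
          σ' v x0        ≡⟨ σ'-into-x0 v ⟩
          not true       ≡⟨ cong not (sym (trans (σ₀-x0 Tuv u≡x0) uv)) ⟩
          not (σ₀ u v)   ∎
        byEnds (no u≢x0) (yes v≡x0) = begin
          σ₀ v u         ≡⟨ σ₀-x0 Tvu v≡x0 ⟩
          adj G v u      ≡⟨ trans (SimpleGraph.sym G v u) uv ⟩
          not false      ≡⟨ cong not (sym (σ'-into-x0 u)) ⟩
          not (σ' u x0)  ≡⟨ cong (not ∘ σ' u) (sym v≡x0) ⟩
          not (σ' u v)   ≡⟨ cong not (sym (σ₀-σ' Tuv u≢x0)) ⟩
          not (σ₀ u v)   ∎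
        byEnds (no u≢x0) (no v≢x0) = begin
          σ₀ v u         ≡⟨ σ₀-σ' Tvu v≢x0 ⟩
          σ' v u         ≡⟨ exactlyOne⇒not (proj₂ σ'-orients u v (Rest-intro uv Tuv u≢x0 v≢x0)) ⟩
          not (σ' u v)   ≡⟨ cong not (sym (σ₀-σ' Tuv u≢x0)) ⟩
          not (σ₀ u v)   ∎

  module _ {F : BRel n} (sF : EdgeSubset T F) where

    reversal-orients : Orients (adj G) (F ⊕ σ₀)
    reversal-orients = ⊕-orients sF T⊆G σ₀-orients

    reversal-extends : Extends (F ⊕ σ₀) σ'
    reversal-extends u v e with F u v in Fuv
    ... | false = σ₀-extends u v e
    ... | true with trans (sym (⊆-adj sF u v Fuv)) (σ'-∉T u v e)
    ...   | ()

    reversal-source : ∀ u v → (F ⊕ σ₀) u v ≡ true →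
                      σ' u v ≡ true ⊎ adj T v u ≡ true ⊎ u ≡ x0
    reversal-source u v e with xor≡true (F u v) (σ₀ u v) e
    ... | inj₁ Fuv = inj₂ (inj₁ (⊆-adj sF v u (trans (symmetric sF v u) Fuv)))
    ... | inj₂ σ₀uv with σ₀-source u v σ₀uv
    ...   | inj₁ Tuv         = inj₂ (inj₁ (trans (SimpleGraph.sym T v u) Tuv))
    ...   | inj₂ (inj₁ σ'uv) = inj₁ σ'uv
    ...   | inj₂ (inj₂ u≡x0) = inj₂ (inj₂ u≡x0)

    reversal-indeg-x0 : indeg (F ⊕ σ₀) x0 ≤ deg (adj T) x0
    reversal-indeg-x0 = countIn-mono (allFin n) fromTree
      where
      fromTree : ∀ u → (F ⊕ σ₀) u x0 ≡ true → adj T x0 u ≡ true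
      fromTree u e with reversal-source u x0 e
      ... | inj₁ σ'ux0        = ⊥-elim (true≢false (trans (sym σ'ux0) (σ'-into-x0 u)))
      ... | inj₂ (inj₁ Tx0u)  = Tx0u
      ... | inj₂ (inj₂ u≡x0)  = ⊥-elim (adj-irrefl G (proj₁ reversal-orients u x0 e) u≡x0)

  parityReorientation : Connected (adj T) → (target : Fin n → Parity) →
    Σ (BRel n) λ F → EdgeSubset T F × (∀ v → v ≢ x0 → parity (indeg (F ⊕ σ₀) v) ≡ target v)
  parityReorientation T-connected target
    with parityJoin T-connected x0 (λ v → target v ℙ.+ parity (indeg σ₀ v))
  ... | F , sF , F-parity = F , sF , λ v v≢x0 → begin
    parity (indeg (F ⊕ σ₀) v)
      ≡⟨ parity-indeg-⊕ F σ₀ v ⟩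
    parity (indeg F v) ℙ.+ parity (indeg σ₀ v)
      ≡⟨ cong (ℙ._+ parity (indeg σ₀ v)) (F-parity v v≢x0) ⟩
    (target v ℙ.+ parity (indeg σ₀ v)) ℙ.+ parity (indeg σ₀ v)
      ≡⟨ p+q+q≡p (target v) (parity (indeg σ₀ v)) ⟩
    target v ∎
    where open ≡-Reasoning

lemma3 : ∀ {n : ℕ} (G : SimpleGraph n) (inA : Fin n → Bool) (x0 : Fin n) (T : SimpleGraph n)
    → Connected (adj G)
    → IsBipartition G inA
    → inA x0 ≡ true
    → IsSpanningTree G T
    → deg (adj T) x0 ≡ 1
    → (σ' : BRel n) → IsOrientation (Rest G T x0) σ'
    → Σ (BRel n) λ σ →
        IsOrientation (adj G) σ × Extends σ σ' ×
        (∀ x → inA x ≡ false → 2 ∣ indeg σ x) ×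
        (∀ x → inA x ≡ true → x ≢ x0 → ¬ (2 ∣ indeg σ x)) ×
        (indeg σ x0 ≤ 1) ×
        IsProper G σ ×
        (maxIndeg σ ≤ maxIndeg σ' + maxDeg (adj T) + 1)
lemma3 G inA x0 T _ bip x0∈A (T⊆G , T-connected , _) deg-x0 σ' σ'-orients
  with Reorientation.parityReorientation G T x0 T⊆G σ'-orients T-connected (toParity ∘ inA)
... | F , sF , parity-σ =
  F ⊕ σ₀ , isOrientation , reversal-extends sF , evenOnB , oddOnA , x0≤1 ,
  isProper-byParity G inA isOrientation bip x0∈A parity-σ x0≤1 ,
  maxIndeg-≤-sources (F ⊕ σ₀) σ' (adj T) x0 (reversal-source sF)
  where
  open Reorientation G T x0 T⊆G σ'-orients
  isOrientation : IsOrientation (adj G) (F ⊕ σ₀)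
  isOrientation = orients⇒isOrientation (reversal-orients sF)
  x0≤1 : indeg (F ⊕ σ₀) x0 ≤ 1
  x0≤1 = ℕ.≤-trans (reversal-indeg-x0 sF) (ℕ.≤-reflexive deg-x0)
  evenOnB : ∀ x → inA x ≡ false → 2 ∣ indeg (F ⊕ σ₀) x
  evenOnB x x∈B = parity≡0ℙ⇒2∣ _ (trans (parity-σ x x≢x0) (cong toParity x∈B))
    where
    x≢x0 : x ≢ x0
    x≢x0 refl = true≢false (trans (sym x0∈A) x∈B)
  oddOnA : ∀ x → inA x ≡ true → x ≢ x0 → ¬ (2 ∣ indeg (F ⊕ σ₀) x)
  oddOnA x x∈A x≢x0 2∣ =
    1ℙ≢0ℙ (trans (sym (trans (parity-σ x x≢x0) (cong toParity x∈A))) (2∣⇒parity≡0ℙ 2∣))
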